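{- Let $A$ be a set of primes with $|A| \ge 3$ such that, whenever $q$ is a prime dividing $\prod_{a \in B} a + 1$ for some $B \in \mathcal P_\star(A)$, one has $q \in A$. Then $A$ is the set of all primes.
   Context: For a set $X$, $\mathcal P_\star(X)$ denotes the family of all finite nonempty proper subsets of $X$. -}

module Defs where

open import Level using (0ℓ)
open import Data.Nat using (ℕ; suc; _*_; _+_)
open import Data.Nat.Divisibility using (_∣_)
open import Data.Nat.Primality using (Prime)
open import Data.List using (List; []; _∷_)
open import Data.List.Membership.Propositional using (_∈_; _∉_)
open import Data.List.Relation.Unary.All using (All)
open import Data.List.Relation.Unary.Unique.Propositional using (Unique)
open import Data.Product using (Σ; ∃; _×_; _,_)
open import Relation.Nullary using (¬_)
open import Relation.Binary.PropositionalEquality using (_≡_; _≢_)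
open import Relation.Unary using (Pred; _∈_)

Subset : Set₁
Subset = Pred ℕ 0ℓ

-- A finite subset B is presented by a duplicate-free list of its elements.
-- B ∈ 𝒫⋆(A): B is finite, nonempty, B ⊆ A, and B ≠ A (some a ∈ A is not in B).
record FinNonemptyProperSubset (A : Subset) (B : List ℕ) : Set where
  field
    unique   : Unique B
    nonempty : B ≢ []
    sub      : All A B
    proper   : Σ ℕ (λ a → A a × a ∉ B)

AtLeast3 : Subset → Set
AtLeast3 A = Σ ℕ λ x → Σ ℕ λ y → Σ ℕ λ z →
  A x × A y × A z × x ≢ y × x ≢ z × y ≢ z

SetOfPrimes : Subset → Set
SetOfPrimes A = ∀ p → A p → Prime p

module Submission where

-- ClosedSet: A contains 2 (a + 1 is even for an odd a ∈ A) and is infinite.  For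
-- a finite X ⊆ A, two odd members a ≠ c and C = ({c} ∪ X) ∖ {2, a}, Q = ∏C, if
-- all prime divisors of aQ + 1, 2Q + 1 and Q + 1 lay in X these numbers would be
-- 2^j, a^k and 2^i, which is impossible modulo 4.
--
-- Completion: for an odd prime p and a finite L ⊆ A prime to p, call a residue
-- class rich when L has at least 2p members in it.  Products of members of rich
-- classes realise every product of rich residues.  With f the product of the
-- other members of L, follow the orbit of 0 under x ↦ f·x + 1, which returns to
-- 0 mod p: a realised x gives B ∈ 𝒫⋆(A) with ∏B + 1 ≡ f·x + 1, so either p ∈ A,
-- or f·x + 1 is realised again, or ∏B + 1 has a new prime divisor in A outside
-- the rich classes.  Adding the newcomer to L raises a bounded measure, so
-- eventually p ∈ A.

open import Defs
open import Data.Nat using (ℕ; suc; _+_)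
open import Data.Nat.Divisibility using (_∣_)
open import Data.Nat.Primality using (Prime)
open import Data.List using (List)
open import Data.Nat.ListAction using (product)

open import Data.Nat.Base using (zero; _*_; _∸_; _^_; _≤_; _<_; z≤n; s≤s; NonZero; _%_; _/_; _⊓_; nonTrivial⇒n>1)
open import Data.Nat.Properties
open import Data.Nat.DivMod using (m%n<n; %-distribˡ-+; %-distribˡ-*; %-pred-≡0; m*n%n≡0; m%n%n≡m%n; m≡m%n+[m/n]*n; %-remove-+ˡ; n%n≡0)
open import Data.Nat.Divisibility using (divides; ∣⇒≤; ∣-refl; ∣n∣m%n⇒∣m; ∣1⇒≡1; ∣m+n∣m⇒∣n; m%n≡0⇒n∣m; n∣m⇒m%n≡0; m∣m*n)
open import Data.Nat.Primality using (euclidsLemma; prime⇒irreducible; prime⇒nonTrivial; prime⇒nonZero; ¬prime[1]; prime[2])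
open import Data.Nat.Primality.Factorisation using (factorise; PrimeFactorisation; factorisationHasAllPrimeFactors)
open import Data.Nat.ListAction.Properties using (∈⇒∣product; ∈⇒≤product; product-++)
open import Data.List.Base using ([]; _∷_; _++_; length; filter; deduplicate; take)
open import Data.List.Membership.Propositional using (_∈_; _∉_; find)
open import Data.List.Membership.Propositional.Properties
  using (∈-filter⁺; ∈-filter⁻; ∈-deduplicate⁺; ∈-deduplicate⁻; ∈-++⁺ˡ; ∈-++⁺ʳ; ∈-++⁻)
open import Data.List.Membership.DecPropositional _≟_ using (_∈?_)
open import Data.List.Relation.Unary.Any using (here; there)
open import Data.List.Relation.Unary.All as All using (All; []; _∷_; all?)
open import Data.List.Relation.Unary.All.Properties using (¬All⇒Any¬; ¬Any⇒All¬; take⁺)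
open import Data.List.Relation.Unary.Unique.Propositional using (Unique; []; _∷_)
import Data.List.Relation.Unary.Unique.Propositional.Properties as Unique
open import Data.List.Relation.Unary.Unique.DecPropositional.Properties _≟_ using (deduplicate-!)
open import Data.Product using (∃; _×_; _,_; proj₁; proj₂)
open import Data.Sum using (_⊎_; inj₁; inj₂; map₂; [_,_]′)
open import Data.Empty using (⊥; ⊥-elim)
open import Function.Base using (_∘_; id)
open import Relation.Nullary using (¬_; Dec; yes; no; ¬?; _×-dec_; contradiction)
import Relation.Unary as U
import Data.Fin.Base as Fin
import Data.Fin.Properties as Fin
open import Data.List.Properties using (length-take; filter-accept; filter-reject)
open import Relation.Binary.PropositionalEquality
open import Data.Nat.Tactic.RingSolver using (solve-∀)

prime≥2 : ∀ {q} → Prime q → 2 ≤ q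
prime≥2 {q} q-prime = nonTrivial⇒n>1 q {{prime⇒nonTrivial q-prime}}

prime∤1 : ∀ {q} → Prime q → ¬ q ∣ 1
prime∤1 q-prime q∣1 = <⇒≢ (prime≥2 q-prime) (sym (∣1⇒≡1 q∣1))

∈⇒∤product+1 : ∀ {q B} → Prime q → q ∈ B → ¬ q ∣ product B + 1
∈⇒∤product+1 q-prime q∈B q∣ = prime∤1 q-prime (∣m+n∣m⇒∣n q∣ (∈⇒∣product q∈B))

prime∣prime⇒≡ : ∀ {d x} → Prime x → Prime d → d ∣ x → d ≡ x
prime∣prime⇒≡ x-prime d-prime d∣x with prime⇒irreducible x-prime d∣x
... | inj₁ refl = contradiction d-prime ¬prime[1]
... | inj₂ d≡x  = d≡x

2∣odd+1 : ∀ x → ¬ 2 ∣ x → 2 ∣ x + 1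
2∣odd+1 x 2∤x with x % 2 in x%2 | m%n<n x 2
... | 0           | _ = contradiction (m%n≡0⇒n∣m x 2 x%2) 2∤x
... | 1           | _ = m%n≡0⇒n∣m (x + 1) 2 (trans (%-distribˡ-+ x 1 2) (cong (λ v → (v + 1) % 2) x%2))
... | suc (suc _) | s≤s (s≤s ())

+1-nonZero : ∀ n → NonZero (n + 1)
+1-nonZero zero    = _
+1-nonZero (suc n) = _

product-of-prime-divisors : ∀ {P : ℕ → Set} N .{{_ : NonZero N}} →
  (∀ {q} → Prime q → q ∣ N → P q) → ∃ λ fs → All P fs × product fs ≡ N
product-of-prime-divisors N all-P =
  factors , All.tabulate (λ q∈ → all-P (All.lookup factorsPrime q∈) (∈⇒∣N q∈)) , sym isFactorisation
  where
  open PrimeFactorisation (factorise N)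
  ∈⇒∣N : ∀ {q} → q ∈ factors → q ∣ N
  ∈⇒∣N q∈ = subst (_ ∣_) (sym isFactorisation) (∈⇒∣product q∈)

prime-divisors-dichotomy : ∀ {P : ℕ → Set} → U.Decidable P → ∀ N .{{_ : NonZero N}} →
  (∃ λ q → Prime q × q ∣ N × ¬ P q) ⊎ (∀ {q} → Prime q → q ∣ N → P q)
prime-divisors-dichotomy P? N with all? P? (PrimeFactorisation.factors (factorise N))
... | yes all-P = inj₂ λ q-prime q∣N → All.lookup all-P
        (factorisationHasAllPrimeFactors q-prime (subst (_ ∣_) isFactorisation q∣N) factorsPrime)
  where open PrimeFactorisation (factorise N)
... | no ¬all-P =
  let q , q∈ , ¬Pq = find (¬All⇒Any¬ P? factors ¬all-P)
  in  inj₁ (q , All.lookup factorsPrime q∈ , subst (q ∣_) (sym isFactorisation) (∈⇒∣product q∈) , ¬Pq)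
  where open PrimeFactorisation (factorise N)

product-const : ∀ {s} fs → All (_≡ s) fs → product fs ≡ s ^ length fs
product-const []       []            = refl
product-const (f ∷ fs) (refl ∷ f≡s) = cong (f *_) (product-const fs f≡s)

prime-power : ∀ n s .{{_ : NonZero n}} → (∀ {q} → Prime q → q ∣ n → q ≡ s) → ∃ λ k → n ≡ s ^ k
prime-power n s only-s =
  let fs , all-s , ∏fs≡n = product-of-prime-divisors n only-s
  in  length fs , trans (sym ∏fs≡n) (product-const fs all-s)

2^k≡0[4] : ∀ k → 3 ≤ 2 ^ k → 2 ^ k % 4 ≡ 0
2^k≡0[4] 0             (s≤s ())
2^k≡0[4] 1             (s≤s (s≤s ()))
2^k≡0[4] (suc (suc k)) _ =
  trans (cong (_% 4) (trans (sym (*-assoc 2 2 (2 ^ k))) (*-comm 4 (2 ^ k)))) (m*n%n≡0 (2 ^ k) 4)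

pred-of-2^k : ∀ x k → 2 ≤ x → x + 1 ≡ 2 ^ k → x % 4 ≡ 3
pred-of-2^k x k x≥2 x+1≡2^k = %-pred-≡0 {x} {4} (trans (cong (_% 4) (trans (+-comm 1 x) x+1≡2^k))
  (2^k≡0[4] k (subst (3 ≤_) x+1≡2^k (+-monoˡ-≤ 1 x≥2))))

^≡1[4] : ∀ a k → a % 4 ≡ 1 → a ^ k % 4 ≡ 1
^≡1[4] a zero    a≡1 = refl
^≡1[4] a (suc k) a≡1 = begin
  (a * a ^ k) % 4                 ≡⟨ %-distribˡ-* a (a ^ k) 4 ⟩
  ((a % 4) * ((a ^ k) % 4)) % 4  ≡⟨ cong₂ (λ u v → (u * v) % 4) a≡1 (^≡1[4] a k a≡1) ⟩
  1                               ∎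
  where open ≡-Reasoning

-- 3 is its own inverse modulo 4: if a·Q ≡ 3 and Q ≡ 3 then a ≡ 1.
cancel-3[4] : ∀ a Q → Q % 4 ≡ 3 → (a * Q) % 4 ≡ 3 → a % 4 ≡ 1
cancel-3[4] a Q Q≡3 aQ≡3 = residue (a % 4) (m%n<n a 4)
  (trans (cong (λ v → ((a % 4) * v) % 4) (sym Q≡3)) (trans (sym (%-distribˡ-* a Q 4)) aQ≡3))
  where
  residue : ∀ r → r < 4 → (r * 3) % 4 ≡ 3 → r ≡ 1
  residue 1 _ _ = refl
  residue 0 _ ()
  residue 2 _ ()
  residue 3 _ ()
  residue (suc (suc (suc (suc _)))) (s≤s (s≤s (s≤s (s≤s ())))) _

-- There are no a ≥ 1, Q ≥ 2 with Q + 1 and a·Q + 1 powers of 2 and 2·Q + 1 a power of a: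
-- modulo 4 the first two force Q ≡ 3 and a ≡ 1, but then 2·Q + 1 ≡ 3 while a^k ≡ 1.
no-power-triple : ∀ {a Q i j k} → 1 ≤ a → 2 ≤ Q →
  Q + 1 ≡ 2 ^ i → a * Q + 1 ≡ 2 ^ j → 2 * Q + 1 ≡ a ^ k → ⊥
no-power-triple {a} {Q} {i} {j} {k} a≥1 Q≥2 Q+1≡2^i aQ+1≡2^j 2Q+1≡a^k =
  contradiction (trans (sym 2Q+1≡3) (trans (cong (_% 4) 2Q+1≡a^k) (^≡1[4] a k a≡1))) λ ()
  where
  Q≡3 : Q % 4 ≡ 3
  Q≡3 = pred-of-2^k Q i Q≥2 Q+1≡2^i
  a≡1 : a % 4 ≡ 1
  a≡1 = cancel-3[4] a Q Q≡3 (pred-of-2^k (a * Q) j (*-mono-≤ a≥1 Q≥2) aQ+1≡2^j)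
  2Q+1≡3 : (2 * Q + 1) % 4 ≡ 3
  2Q+1≡3 = begin
    (2 * Q + 1) % 4               ≡⟨ %-distribˡ-+ (2 * Q) 1 4 ⟩
    ((2 * Q) % 4 + 1) % 4         ≡⟨ cong (λ v → (v + 1) % 4) (%-distribˡ-* 2 Q 4) ⟩
    ((2 * (Q % 4)) % 4 + 1) % 4   ≡⟨ cong (λ v → ((2 * v) % 4 + 1) % 4) Q≡3 ⟩
    3                             ∎
    where open ≡-Reasoning

Closed : Subset → Set
Closed A = ∀ (B : List ℕ) → FinNonemptyProperSubset A B → ∀ q → Prime q → q ∣ product B + 1 → A q

∈⇒≢[] : ∀ {x : ℕ} {B} → x ∈ B → B ≢ []
∈⇒≢[] (here _)  ()
∈⇒≢[] (there _) ()

in-𝒫⋆ : ∀ {A : Subset} {B x y} → Unique B → All A B → x ∈ B → A y → y ∉ B →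
  FinNonemptyProperSubset A B
in-𝒫⋆ B-unique B⊆A x∈B y∈A y∉B = record
  { unique = B-unique ; nonempty = ∈⇒≢[] x∈B ; sub = B⊆A ; proper = _ , y∈A , y∉B }

∷-unique : ∀ {x : ℕ} {S} → x ∉ S → Unique S → Unique (x ∷ S)
∷-unique {S = S} x∉S S-unique = ¬Any⇒All¬ S x∉S ∷ S-unique

record OddPair (A : Subset) : Set where
  field
    a c : ℕ
    a∈A : A a
    c∈A : A c
    a≢2 : a ≢ 2
    c≢2 : c ≢ 2
    a≢c : a ≢ c

-- Among three distinct members at most one equals 2.
odd-pair : ∀ {A} → AtLeast3 A → OddPair A
odd-pair (x , y , z , x∈A , y∈A , z∈A , x≢y , x≢z , y≢z) with x ≟ 2 | y ≟ 2
... | yes refl | _        = record { a = y ; c = z ; a∈A = y∈A ; c∈A = z∈A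
                                   ; a≢2 = x≢y ∘ sym ; c≢2 = x≢z ∘ sym ; a≢c = y≢z }
... | no x≢2  | yes refl = record { a = x ; c = z ; a∈A = x∈A ; c∈A = z∈A
                                   ; a≢2 = x≢2 ; c≢2 = y≢z ∘ sym ; a≢c = x≢z }
... | no x≢2  | no y≢2   = record { a = x ; c = y ; a∈A = x∈A ; c∈A = y∈A
                                   ; a≢2 = x≢2 ; c≢2 = y≢2 ; a≢c = x≢y }

module ClosedSet {A : Subset} (A-primes : SetOfPrimes A) (closed : Closed A) where

  -- {a} ∈ 𝒫⋆(A) for an odd prime a ∈ A, and 2 divides the even number a + 1.
  2∈A : OddPair A → A 2
  2∈A pair = closed (a ∷ []) singleton 2 prime[2] 2∣a+1
    where
    open OddPair pair
    singleton : FinNonemptyProperSubset A (a ∷ [])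
    singleton = in-𝒫⋆ ([] ∷ []) (a∈A ∷ []) (here refl) c∈A λ { (here c≡a) → a≢c (sym c≡a) ; (there ()) }
    2∤a : ¬ 2 ∣ a
    2∤a 2∣a = a≢2 (sym (prime∣prime⇒≡ (A-primes a a∈A) prime[2] 2∣a))
    2∣a+1 : 2 ∣ product (a ∷ []) + 1
    2∣a+1 = subst (λ w → 2 ∣ w + 1) (sym (*-identityʳ a)) (2∣odd+1 a 2∤a)

  new-or-covered : ∀ {B} → FinNonemptyProperSubset A B → (X : List ℕ) →
    (∃ λ q → A q × q ∉ X) ⊎ (∀ {q} → Prime q → q ∣ product B + 1 → q ∈ X)
  new-or-covered {B} B⋆ X with prime-divisors-dichotomy (_∈? X) (product B + 1) {{+1-nonZero _}}
  ... | inj₁ (q , q-prime , q∣ , q∉X) = inj₁ (q , closed B B⋆ q q-prime q∣ , q∉X)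
  ... | inj₂ covered                  = inj₂ covered

  -- Given a finite X ⊆ A, let C = ({c} ∪ X) ∖ {2, a} and Q = ∏ C. If X covered the
  -- prime divisors of aQ + 1, 2Q + 1 and Q + 1 (products over {a} ∪ C, {2} ∪ C and C),
  -- these would be 2^j, a^k and 2^i, which no-power-triple rules out.
  module Escape (pair : OddPair A) (X : List ℕ) (X⊆A : All A X) where
    open OddPair pair

    avoids? : U.Decidable (λ x → x ≢ 2 × x ≢ a)
    avoids? x = ¬? (x ≟ 2) ×-dec ¬? (x ≟ a)

    C : List ℕ
    C = filter avoids? (deduplicate _≟_ (c ∷ X))

    ∈C⁻ : ∀ {x} → x ∈ C → x ∈ c ∷ X × x ≢ 2 × x ≢ a
    ∈C⁻ x∈C = let x∈ , avoids = ∈-filter⁻ avoids? x∈C in ∈-deduplicate⁻ _≟_ (c ∷ X) x∈ , avoids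

    ∈C⁺ : ∀ {x} → x ∈ c ∷ X → x ≢ 2 → x ≢ a → x ∈ C
    ∈C⁺ x∈ x≢2 x≢a = ∈-filter⁺ avoids? (∈-deduplicate⁺ _≟_ x∈) (x≢2 , x≢a)

    C-unique : Unique C
    C-unique = Unique.filter⁺ avoids? (deduplicate-! (c ∷ X))

    C⊆A : All A C
    C⊆A = All.tabulate λ x∈C → All.lookup (c∈A ∷ X⊆A) (proj₁ (∈C⁻ x∈C))

    c∈C : c ∈ C
    c∈C = ∈C⁺ (here refl) c≢2 (a≢c ∘ sym)

    2∉C : 2 ∉ C
    2∉C 2∈C = proj₁ (proj₂ (∈C⁻ 2∈C)) refl

    a∉C : a ∉ C
    a∉C a∈C = proj₂ (proj₂ (∈C⁻ a∈C)) refl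

    aC⋆ : FinNonemptyProperSubset A (a ∷ C)
    aC⋆ = in-𝒫⋆ (∷-unique a∉C C-unique) (a∈A ∷ C⊆A) (here refl) (2∈A pair)
      λ { (here 2≡a) → a≢2 (sym 2≡a) ; (there 2∈C) → 2∉C 2∈C }

    2C⋆ : FinNonemptyProperSubset A (2 ∷ C)
    2C⋆ = in-𝒫⋆ (∷-unique 2∉C C-unique) (2∈A pair ∷ C⊆A) (here refl) a∈A
      λ { (here a≡2) → a≢2 a≡2 ; (there a∈C) → a∉C a∈C }

    C⋆ : FinNonemptyProperSubset A C
    C⋆ = in-𝒫⋆ C-unique C⊆A c∈C (2∈A pair) 2∉C

    Q : ℕ
    Q = product C

    -- Q ≥ c ≥ 2.
    Q≥2 : 2 ≤ Q
    Q≥2 = ≤-trans (prime≥2 (A-primes c c∈A))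
      (∈⇒≤product (All.map (λ {x} x∈A → prime⇒nonZero (A-primes x x∈A)) C⊆A) c∈C)

    outside-C : ∀ {q} → q ∈ X → q ∉ C → q ≡ 2 ⊎ q ≡ a
    outside-C {q} q∈X q∉C with q ≟ 2 | q ≟ a
    ... | yes q≡2 | _       = inj₁ q≡2
    ... | no _   | yes q≡a = inj₂ q≡a
    ... | no q≢2 | no q≢a  = contradiction (∈C⁺ (there q∈X) q≢2 q≢a) q∉C

    Covered : List ℕ → Set
    Covered B = ∀ {q} → Prime q → q ∣ product B + 1 → q ∈ X

    covered-divisor : ∀ {B q} → Covered B → (∀ {x} → x ∈ C → x ∈ B) →
      Prime q → q ∣ product B + 1 → q ≡ 2 ⊎ q ≡ a
    covered-divisor covered C⊆B q-prime q∣ =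
      outside-C (covered q-prime q∣) (λ q∈C → ∈⇒∤product+1 q-prime (C⊆B q∈C) q∣)

    aQ+1-power : Covered (a ∷ C) → ∃ λ j → a * Q + 1 ≡ 2 ^ j
    aQ+1-power covered = prime-power (a * Q + 1) 2 {{+1-nonZero _}} only-2
      where
      only-2 : ∀ {q} → Prime q → q ∣ a * Q + 1 → q ≡ 2
      only-2 q-prime q∣ with covered-divisor {a ∷ C} covered there q-prime q∣
      ... | inj₁ q≡2 = q≡2
      ... | inj₂ refl = contradiction q∣ (∈⇒∤product+1 {B = a ∷ C} q-prime (here refl))

    2Q+1-power : Covered (2 ∷ C) → ∃ λ k → 2 * Q + 1 ≡ a ^ k
    2Q+1-power covered = prime-power (2 * Q + 1) a {{+1-nonZero _}} only-a
      where
      only-a : ∀ {q} → Prime q → q ∣ 2 * Q + 1 → q ≡ a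
      only-a q-prime q∣ with covered-divisor {2 ∷ C} covered there q-prime q∣
      ... | inj₁ refl = contradiction q∣ (∈⇒∤product+1 {B = 2 ∷ C} q-prime (here refl))
      ... | inj₂ q≡a = q≡a

    -- 2Q + 1 > 1, so a power of a equal to it is divisible by a.
    a∣2Q+1 : ∀ {k} → 2 * Q + 1 ≡ a ^ k → a ∣ 2 * Q + 1
    a∣2Q+1 {zero}  2Q+1≡1 = ⊥-elim (<⇒≢ (+-monoˡ-< 1 (≤-trans (s≤s z≤n) (≤-trans Q≥2 (m≤n*m Q 2)))) (sym 2Q+1≡1))
    a∣2Q+1 {suc k} 2Q+1≡a^k = subst (a ∣_) (sym 2Q+1≡a^k) (m∣m*n (a ^ k))

    -- a cannot divide Q + 1 as well, since then a ∣ (2Q + 1) − (Q + 1) = Q.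
    Q+1-power : Covered C → a ∣ 2 * Q + 1 → ∃ λ i → Q + 1 ≡ 2 ^ i
    Q+1-power covered a∣2Q+1 = prime-power (Q + 1) 2 {{+1-nonZero _}} only-2
      where
      only-2 : ∀ {q} → Prime q → q ∣ Q + 1 → q ≡ 2
      only-2 q-prime q∣ with covered-divisor {C} covered (λ x∈C → x∈C) q-prime q∣
      ... | inj₁ q≡2 = q≡2
      ... | inj₂ refl = contradiction (∣m+n∣m⇒∣n q∣ a∣Q) (prime∤1 q-prime)
        where
        split : ∀ n → 2 * n + 1 ≡ (n + 1) + n
        split = solve-∀
        a∣Q : a ∣ Q
        a∣Q = ∣m+n∣m⇒∣n (subst (a ∣_) (split Q) a∣2Q+1) q∣

    escape : ∃ λ q → A q × q ∉ X
    escape with new-or-covered aC⋆ X | new-or-covered 2C⋆ X | new-or-covered C⋆ X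
    ... | inj₁ new | _        | _        = new
    ... | inj₂ _   | inj₁ new | _        = new
    ... | inj₂ _   | inj₂ _   | inj₁ new = new
    ... | inj₂ cov-aC | inj₂ cov-2C | inj₂ cov-C =
      let j , aQ+1≡2^j = aQ+1-power cov-aC
          k , 2Q+1≡a^k = 2Q+1-power cov-2C
          i , Q+1≡2^i  = Q+1-power cov-C (a∣2Q+1 {k} 2Q+1≡a^k)
      in  ⊥-elim (no-power-triple {a} {Q} {i} {j} {k} (≤-trans (s≤s z≤n) (prime≥2 (A-primes a a∈A))) Q≥2
                    Q+1≡2^i aQ+1≡2^j 2Q+1≡a^k)

  unbounded : OddPair A → ∀ X → All A X → ∃ λ q → A q × q ∉ X
  unbounded pair X X⊆A = Escape.escape pair X X⊆A

∈-take⁻ : ∀ {x : ℕ} k xs → x ∈ take k xs → x ∈ xs × 1 ≤ k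
∈-take⁻ (suc k) (y ∷ xs) (here refl) = here refl , s≤s z≤n
∈-take⁻ (suc k) (y ∷ xs) (there x∈) = there (proj₁ (∈-take⁻ k xs x∈)) , s≤s z≤n

take-inhabited : ∀ k (xs : List ℕ) → 1 ≤ k → 1 ≤ length xs → ∃ λ x → x ∈ take k xs
take-inhabited (suc k) (x ∷ xs) _ _ = x , here refl

monomial : ℕ → (ℕ → ℕ) → ℕ
monomial zero    e = 1
monomial (suc n) e = monomial n e * n ^ e n

monomial-cong : ∀ n {e e′} → (∀ r → r < n → e r ≡ e′ r) → monomial n e ≡ monomial n e′
monomial-cong zero    e≡e′ = refl
monomial-cong (suc n) e≡e′ = cong₂ (λ u v → u * n ^ v)
  (monomial-cong n (λ r r<n → e≡e′ r (m<n⇒m<1+n r<n))) (e≡e′ n (n<1+n n))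

update : (ℕ → ℕ) → ℕ → ℕ → ℕ → ℕ
update e r₀ k r with r ≟ r₀
... | yes _ = k
... | no  _ = e r

update-same : ∀ e r₀ k → update e r₀ k r₀ ≡ k
update-same e r₀ k with r₀ ≟ r₀
... | yes _    = refl
... | no r₀≢r₀ = contradiction refl r₀≢r₀

update-other : ∀ e r₀ k {r} → r ≢ r₀ → update e r₀ k r ≡ e r
update-other e r₀ k {r} r≢r₀ with r ≟ r₀
... | yes r≡r₀ = contradiction r≡r₀ r≢r₀
... | no _     = refl

update-self : ∀ e r₀ r → update e r₀ (e r₀) r ≡ e r
update-self e r₀ r with r ≟ r₀
... | yes refl = refl
... | no _     = refl

monomial-split : ∀ n e {r₀} → r₀ < n → ∃ λ W → ∀ k → monomial n (update e r₀ k) ≡ W * r₀ ^ k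
monomial-split (suc n) e {r₀} r₀<1+n with r₀ ≟ n
... | yes refl = monomial n e , λ k → cong₂ _*_
        (monomial-cong n (λ r r<n → update-other e n k (<⇒≢ r<n)))
        (cong (n ^_) (update-same e n k))
... | no r₀≢n =
  let W , split = monomial-split n e (≤∧≢⇒< (≤-pred r₀<1+n) r₀≢n)
  in  W * n ^ e n , λ k → begin
    monomial n (update e r₀ k) * n ^ update e r₀ k n
      ≡⟨ cong₂ _*_ (split k) (cong (n ^_) (update-other e r₀ k (r₀≢n ∘ sym))) ⟩
    W * r₀ ^ k * n ^ e n
      ≡⟨ swap W (r₀ ^ k) (n ^ e n) ⟩
    W * n ^ e n * r₀ ^ k ∎
  where
  open ≡-Reasoning
  swap : ∀ x y z → x * y * z ≡ x * z * y
  swap = solve-∀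

-- The orbit of 0 under x ↦ f·x + 1, i.e. orbit f k = 1 + f + ⋯ + f^(k−1).
orbit : ℕ → ℕ → ℕ
orbit f zero    = 0
orbit f (suc k) = f * orbit f k + 1

-- The geometric-sum identity (f − 1)·orbit f k = f^k − 1, in subtraction-free form.
orbit-geometric : ∀ f k → f ^ k + orbit f k ≡ orbit f (suc k)
orbit-geometric f zero    = cong (_+ 1) (sym (*-zeroʳ f))
orbit-geometric f (suc k) = begin
  f * f ^ k + (f * orbit f k + 1) ≡⟨ factor f (f ^ k) (orbit f k) ⟩
  f * (f ^ k + orbit f k) + 1     ≡⟨ cong (λ v → f * v + 1) (orbit-geometric f k) ⟩
  f * orbit f (suc k) + 1         ∎
  where
  open ≡-Reasoning
  factor : ∀ f a x → f * a + (f * x + 1) ≡ f * (a + x) + 1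
  factor = solve-∀

module Modulo {p : ℕ} (p-prime : Prime p) where

  instance
    p≢0 : NonZero p
    p≢0 = prime⇒nonZero p-prime

  infix 4 _≈_
  _≈_ : ℕ → ℕ → Set
  x ≈ y = x % p ≡ y % p

  ≈-+ : ∀ {x y u v} → x ≈ u → y ≈ v → x + y ≈ u + v
  ≈-+ {x} {y} {u} {v} x≈u y≈v =
    trans (%-distribˡ-+ x y p) (trans (cong₂ (λ s t → (s + t) % p) x≈u y≈v) (sym (%-distribˡ-+ u v p)))

  ≈-* : ∀ {x y u v} → x ≈ u → y ≈ v → x * y ≈ u * v
  ≈-* {x} {y} {u} {v} x≈u y≈v =
    trans (%-distribˡ-* x y p) (trans (cong₂ (λ s t → (s * t) % p) x≈u y≈v) (sym (%-distribˡ-* u v p)))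

  %-≈ : ∀ x → x % p ≈ x
  %-≈ x = m%n%n≡m%n x p

  ∣-resp-≈ : ∀ {x y} → x ≈ y → p ∣ y → p ∣ x
  ∣-resp-≈ {x} {y} x≈y p∣y = m%n≡0⇒n∣m x p (trans x≈y (n∣m⇒m%n≡0 y p p∣y))

  ≈⇒∣∸ : ∀ x y → x ≈ y → p ∣ y ∸ x
  ≈⇒∣∸ x y x≈y = divides (y / p ∸ x / p) (begin
    y ∸ x                                          ≡⟨ cong₂ _∸_ (m≡m%n+[m/n]*n y p) (m≡m%n+[m/n]*n x p) ⟩
    (y % p + (y / p) * p) ∸ (x % p + (x / p) * p) ≡⟨ cong (λ v → (y % p + (y / p) * p) ∸ (v + (x / p) * p)) x≈y ⟩
    (y % p + (y / p) * p) ∸ (y % p + (x / p) * p) ≡⟨ [m+n]∸[m+o]≡n∸o (y % p) _ _ ⟩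
    (y / p) * p ∸ (x / p) * p                      ≡⟨ sym (*-distribʳ-∸ p (y / p) (x / p)) ⟩
    (y / p ∸ x / p) * p                            ∎)
    where open ≡-Reasoning

  ∣∸1⇒≈1 : ∀ {y} → 1 ≤ y → p ∣ y ∸ 1 → y ≈ 1
  ∣∸1⇒≈1 {y} y≥1 p∣y∸1 = trans (cong (_% p) (sym (m∸n+n≡m y≥1))) (%-remove-+ˡ 1 p∣y∸1)

  ∤⇒≥1 : ∀ {r} → ¬ p ∣ r → 1 ≤ r
  ∤⇒≥1 {zero}  p∤0 = contradiction (divides 0 refl) p∤0
  ∤⇒≥1 {suc r} _   = s≤s z≤n

  ∤-* : ∀ {x y} → ¬ p ∣ x → ¬ p ∣ y → ¬ p ∣ x * y
  ∤-* {x} {y} p∤x p∤y p∣xy with euclidsLemma x y p-prime p∣xy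
  ... | inj₁ p∣x = p∤x p∣x
  ... | inj₂ p∣y = p∤y p∣y

  ∤-^ : ∀ {r} k → ¬ p ∣ r → ¬ p ∣ r ^ k
  ∤-^ zero    p∤r = prime∤1 p-prime
  ∤-^ (suc k) p∤r = ∤-* p∤r (∤-^ k p∤r)

  ∤-product : ∀ {xs} → All (λ x → ¬ p ∣ x) xs → ¬ p ∣ product xs
  ∤-product []            = prime∤1 p-prime
  ∤-product (p∤x ∷ p∤xs) = ∤-* p∤x (∤-product p∤xs)

  cancel : ∀ x y → ¬ p ∣ x → 1 ≤ y → x ≈ x * y → y ≈ 1
  cancel x y p∤x y≥1 x≈xy with euclidsLemma x (y ∸ 1) p-prime p∣x[y∸1]
    where
    p∣x[y∸1] : p ∣ x * (y ∸ 1)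
    p∣x[y∸1] = subst (p ∣_) (sym (trans (*-distribˡ-∸ x y 1) (cong (x * y ∸_) (*-identityʳ x))))
                 (≈⇒∣∸ x (x * y) x≈xy)
  ... | inj₁ p∣x   = contradiction p∣x p∤x
  ... | inj₂ p∣y∸1 = ∣∸1⇒≈1 y≥1 p∣y∸1

  -- Every r prime to p has an order: r^d ≈ 1 for some 1 ≤ d ≤ p.  Two of the
  -- p + 1 powers r^0, …, r^p share a residue, and r^i cancels from r^i ≈ r^i · r^(j−i).
  order : ∀ r → ¬ p ∣ r → ∃ λ d → 1 ≤ d × d ≤ p × r ^ d ≈ 1
  order r p∤r with Fin.pigeonhole (n<1+n p) residue
    where
    residue : Fin.Fin (suc p) → Fin.Fin p
    residue k = Fin.fromℕ< (m%n<n (r ^ Fin.toℕ k) p)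
  ... | i′ , j′ , i<j , same-residue =
    j ∸ i , m<n⇒0<n∸m i<j , ≤-trans (m∸n≤m j i) (≤-pred (Fin.toℕ<n j′)) ,
    cancel (r ^ i) (r ^ (j ∸ i)) (∤-^ i p∤r) (∤⇒≥1 (∤-^ (j ∸ i) p∤r)) r^i≈r^i*r^[j∸i]
    where
    i = Fin.toℕ i′
    j = Fin.toℕ j′
    r^i≈r^j : r ^ i ≈ r ^ j
    r^i≈r^j = trans (sym (Fin.toℕ-fromℕ< (m%n<n (r ^ i) p)))
                (trans (cong Fin.toℕ same-residue) (Fin.toℕ-fromℕ< (m%n<n (r ^ j) p)))
    r^i≈r^i*r^[j∸i] : r ^ i ≈ r ^ i * r ^ (j ∸ i)
    r^i≈r^i*r^[j∸i] = trans r^i≈r^j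
      (cong (_% p) (trans (cong (r ^_) (sym (m+[n∸m]≡n (<⇒≤ i<j)))) (^-distribˡ-+-* r i (j ∸ i))))

  orbit-≈ : ∀ f → f ≈ 1 → ∀ k → orbit f k ≈ k
  orbit-≈ f f≈1 zero    = refl
  orbit-≈ f f≈1 (suc k) =
    trans (≈-+ {f * orbit f k} {1} {1 * k} {1} (≈-* {f} {orbit f k} {1} {k} f≈1 (orbit-≈ f f≈1 k)) refl)
          (cong (_% p) (trans (cong (_+ 1) (*-identityˡ k)) (+-comm k 1)))

  -- With d the order of f, (f − 1)·orbit f d = f^d − 1 ≈ 0: either
  -- p ∣ orbit f d, or f ≈ 1 and then orbit f p ≈ p ≈ 0.
  orbit-returns : ∀ f → ¬ p ∣ f → ∃ λ j → p ∣ orbit f (2 + j)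
  orbit-returns f p∤f with order f p∤f
  ... | d , d≥1 , _ , f^d≈1 with euclidsLemma (f ∸ 1) (orbit f d) p-prime p∣[f∸1]X
    where
    X = orbit f d
    X+1≈fX+1 : X + 1 ≈ f * X + 1
    X+1≈fX+1 = trans (cong (_% p) (+-comm X 1))
      (trans (≈-+ {1} {X} {f ^ d} {X} (sym f^d≈1) refl) (cong (_% p) (orbit-geometric f d)))
    [fX+1]∸[X+1] : (f * X + 1) ∸ (X + 1) ≡ (f ∸ 1) * X
    [fX+1]∸[X+1] = begin
      (f * X + 1) ∸ (X + 1) ≡⟨ cong₂ _∸_ (+-comm (f * X) 1) (+-comm X 1) ⟩
      f * X ∸ X             ≡⟨ cong (f * X ∸_) (sym (*-identityˡ X)) ⟩
      f * X ∸ 1 * X         ≡⟨ sym (*-distribʳ-∸ X f 1) ⟩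
      (f ∸ 1) * X           ∎
      where open ≡-Reasoning
    p∣[f∸1]X : p ∣ (f ∸ 1) * X
    p∣[f∸1]X = subst (p ∣_) [fX+1]∸[X+1] (≈⇒∣∸ (X + 1) (f * X + 1) X+1≈fX+1)
  ... | inj₂ p∣X   = returns-at d d≥1 p∣X
    where
    returns-at : ∀ k → 1 ≤ k → p ∣ orbit f k → ∃ λ j → p ∣ orbit f (2 + j)
    returns-at (suc zero)    _ p∣1 = contradiction (subst (p ∣_) (cong (_+ 1) (*-zeroʳ f)) p∣1) (prime∤1 p-prime)
    returns-at (suc (suc j)) _ p∣X = j , p∣X
  ... | inj₁ p∣f∸1 = p ∸ 2 , subst (λ k → p ∣ orbit f k) (sym (m+[n∸m]≡n (prime≥2 p-prime)))
                       (m%n≡0⇒n∣m (orbit f p) p (trans (orbit-≈ f f≈1 p) (n%n≡0 p)))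
    where
    f≈1 : f ≈ 1
    f≈1 = ∣∸1⇒≈1 (∤⇒≥1 p∤f) p∣f∸1

  monomial-≈1 : ∀ n e → (∀ r → r < n → r ^ e r ≈ 1) → monomial n e ≈ 1
  monomial-≈1 zero    e factors≈1 = refl
  monomial-≈1 (suc n) e factors≈1 = ≈-* {monomial n e} {n ^ e n} {1} {1}
    (monomial-≈1 n e (λ r r<n → factors≈1 r (m<n⇒m<1+n r<n))) (factors≈1 n (n<1+n n))

  product-≈-power : ∀ {r} xs → All (λ x → x % p ≡ r) xs → product xs ≈ r ^ length xs
  product-≈-power         []       []              = refl
  product-≈-power {r} (x ∷ xs) (x%p≡r ∷ xs%p≡r) =
    ≈-* {x} {product xs} {r} {r ^ length xs}
      (trans (sym (%-≈ x)) (cong (_% p) x%p≡r)) (product-≈-power xs xs%p≡r)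

  -- Exponents of r prime to p can be kept in [1, cap): the power r^cap is
  -- ≈ r^(cap − d) where d ≤ p is the order of r.  (This is why cap exceeds p.)
  cap : ℕ
  cap = p + p

  p≥1 : 1 ≤ p
  p≥1 = ≤-trans (s≤s z≤n) (prime≥2 p-prime)

  p<cap : p < cap
  p<cap = m<m+n p p≥1

  reduce-exponent : ∀ {r} → ¬ p ∣ r → ∀ k → 1 ≤ k → k ≤ cap →
    ∃ λ k′ → (1 ≤ k′ × k′ < cap) × r ^ k ≈ r ^ k′
  reduce-exponent {r} p∤r k k≥1 k≤cap with k <? cap | order r p∤r
  ... | yes k<cap | _                    = k , (k≥1 , k<cap) , refl
  ... | no  k≮cap | d , d≥1 , d≤p , r^d≈1 = cap ∸ d , (cap∸d≥1 , cap∸d<cap) , r^k≈r^[cap∸d]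
    where
    d≤cap : d ≤ cap
    d≤cap = ≤-trans d≤p (m≤m+n p p)
    cap∸d≥1 : 1 ≤ cap ∸ d
    cap∸d≥1 = ≤-trans p≥1 (subst (_≤ cap ∸ d) (m+n∸m≡n p p) (∸-monoʳ-≤ cap d≤p))
    cap∸d<cap : cap ∸ d < cap
    cap∸d<cap = ∸-monoʳ-< {cap} {d} {0} d≥1 d≤cap
    r^k≡r^[cap∸d]*r^d : r ^ k ≡ r ^ (cap ∸ d) * r ^ d
    r^k≡r^[cap∸d]*r^d = trans (cong (r ^_) (trans (≤-antisym k≤cap (≮⇒≥ k≮cap)) (sym (m∸n+n≡m d≤cap))))
                          (^-distribˡ-+-* r (cap ∸ d) d)
    r^k≈r^[cap∸d] : r ^ k ≈ r ^ (cap ∸ d)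
    r^k≈r^[cap∸d] = trans (cong (_% p) r^k≡r^[cap∸d]*r^d)
      (trans (≈-* {r ^ (cap ∸ d)} {r ^ d} {r ^ (cap ∸ d)} {1} refl r^d≈1) (cong (_% p) (*-identityʳ _)))

  class : List ℕ → ℕ → List ℕ
  class L r = filter (λ q → q % p ≟ r) L

  count : List ℕ → ℕ → ℕ
  count L r = length (class L r)

  ∈-class⁻ : ∀ {x} L r → x ∈ class L r → x ∈ L × x % p ≡ r
  ∈-class⁻ L r = ∈-filter⁻ (λ q → q % p ≟ r)

  select : List ℕ → ℕ → (ℕ → ℕ) → List ℕ
  select L zero    e = []
  select L (suc n) e = select L n e ++ take (e n) (class L n)

  ∈-select⁻ : ∀ {x} L n e → x ∈ select L n e → x ∈ L × x % p < n × 1 ≤ e (x % p)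
  ∈-select⁻ L (suc n) e x∈ with ∈-++⁻ (select L n e) x∈
  ... | inj₁ x∈select with ∈-select⁻ L n e x∈select
  ...   | x∈L , x%p<n , e≥1 = x∈L , m<n⇒m<1+n x%p<n , e≥1
  ∈-select⁻ L (suc n) e x∈ | inj₂ x∈take with ∈-take⁻ (e n) (class L n) x∈take
  ...   | x∈class , e≥1 with ∈-class⁻ L n x∈class
  ...     | x∈L , refl = x∈L , n<1+n _ , e≥1

  ∈-select⁺ : ∀ {x} L n e {r} → r < n → x ∈ take (e r) (class L r) → x ∈ select L n e
  ∈-select⁺ L (suc n) e {r} r<1+n x∈ with r ≟ n
  ... | yes refl = ∈-++⁺ʳ (select L n e) x∈
  ... | no r≢n   = ∈-++⁺ˡ (∈-select⁺ L n e (≤∧≢⇒< (≤-pred r<1+n) r≢n) x∈)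

  -- Distinct classes are disjoint, so selecting from a duplicate-free list gives one.
  select-unique : ∀ L n e → Unique L → Unique (select L n e)
  select-unique L zero    e L-unique = []
  select-unique L (suc n) e L-unique = Unique.++⁺ (select-unique L n e L-unique)
    (Unique.take⁺ (e n) (Unique.filter⁺ (λ q → q % p ≟ n) L-unique)) disjoint
    where
    disjoint : ∀ {v} → ¬ (v ∈ select L n e × v ∈ take (e n) (class L n))
    disjoint (v∈select , v∈take)
      with ∈-select⁻ L n e v∈select | ∈-class⁻ L n (proj₁ (∈-take⁻ (e n) (class L n) v∈take))
    ... | _ , v%p<n , _ | _ , v%p≡n = <-irrefl v%p≡n v%p<n

  product-select : ∀ L n e → (∀ r → r < n → e r ≤ count L r) → product (select L n e) ≈ monomial n e
  product-select L zero    e fits = refl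
  product-select L (suc n) e fits = trans (cong (_% p) (product-++ (select L n e) block))
    (≈-* {product (select L n e)} {product block} {monomial n e} {n ^ e n}
      (product-select L n e (λ r r<n → fits r (m<n⇒m<1+n r<n)))
      (subst (λ k → product block ≈ n ^ k) length-block (product-≈-power block block-residues)))
    where
    block = take (e n) (class L n)
    block-residues : All (λ x → x % p ≡ n) block
    block-residues = take⁺ (e n) (All.tabulate (λ x∈ → proj₂ (∈-class⁻ L n x∈)))
    length-block : length block ≡ e n
    length-block = trans (length-take (e n) (class L n)) (m≤n⇒m⊓n≡m (fits n (n<1+n n)))

  module Realisation (L : List ℕ) where

    Rich : ℕ → Set
    Rich r = 1 ≤ r × r < p × cap ≤ count L r

    rich? : U.Decidable Rich
    rich? r = (1 ≤? r) ×-dec ((suc r ≤? p) ×-dec (cap ≤? count L r))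

    rich⇒∤ : ∀ {r} → Rich r → ¬ p ∣ r
    rich⇒∤ {suc r} (_ , r<p , _) p∣r = <⇒≱ r<p (∣⇒≤ p∣r)

    -- Admissible exponent vectors: exponent in [1, cap) on rich classes, 0 on the others.
    -- Such an e can be realised by select L p e, which then multiplies to monomial p e.
    Admissible : (ℕ → ℕ) → Set
    Admissible e = ∀ r → (Rich r → 1 ≤ e r × e r < cap) × (¬ Rich r → e r ≡ 0)

    admissible-fits : ∀ {e} → Admissible e → ∀ r → e r ≤ count L r
    admissible-fits adm r with rich? r
    ... | yes rich = ≤-trans (<⇒≤ (proj₂ (proj₁ (adm r) rich))) (proj₂ (proj₂ rich))
    ... | no  poor = subst (_≤ count L r) (sym (proj₂ (adm r) poor)) z≤n

    admissible-update : ∀ {e r₀ k} → Admissible e → Rich r₀ → 1 ≤ k → k < cap →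
      Admissible (update e r₀ k)
    admissible-update {e} {r₀} {k} adm rich₀ k≥1 k<cap r with r ≟ r₀
    ... | yes refl = (λ _ → k≥1 , k<cap) , contradiction rich₀
    ... | no  _    = adm r

    Realisable : ℕ → Set
    Realisable x = ∃ λ e → Admissible e × x ≈ monomial p e

    realisable-resp : ∀ {x y} → x ≈ y → Realisable x → Realisable y
    realisable-resp x≈y (e , adm , x≈m) = e , adm , trans (sym x≈y) x≈m

    -- 1 is realised by raising every rich residue to its order.
    realisable-1 : Realisable 1
    realisable-1 = orders , orders-admissible , sym (monomial-≈1 p orders orders-≈1)
      where
      orders : ℕ → ℕ
      orders r with rich? r
      ... | yes rich = proj₁ (order r (rich⇒∤ rich))
      ... | no  _    = 0
      orders-admissible : Admissible orders
      orders-admissible r with rich? r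
      ... | yes rich = (λ _ → let _ , d≥1 , d≤p , _ = order r (rich⇒∤ rich)
                              in  d≥1 , ≤-<-trans d≤p p<cap)
                     , contradiction rich
      ... | no  poor = (λ rich → contradiction rich poor) , λ _ → refl
      orders-≈1 : ∀ r → r < p → r ^ orders r ≈ 1
      orders-≈1 r _ with rich? r
      ... | yes rich = proj₂ (proj₂ (proj₂ (order r (rich⇒∤ rich))))
      ... | no  _    = refl

    -- Realisable residues absorb rich factors: multiplying by w raises the exponent
    -- of its residue r₀ by one, which reduce-exponent brings back below cap.
    realisable-* : ∀ {w x} → Rich (w % p) → Realisable x → Realisable (w * x)
    realisable-* {w} {x} rich (e , adm , x≈m)
      with monomial-split p e (proj₁ (proj₂ rich))
         | reduce-exponent (rich⇒∤ rich) (suc (e (w % p))) (s≤s z≤n) (proj₂ (proj₁ (adm (w % p)) rich))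
    ... | W , split | k , (k≥1 , k<cap) , r₀^[1+c]≈r₀^k =
      update e r₀ k , admissible-update adm rich k≥1 k<cap , wx≈
      where
      r₀ = w % p
      c  = e r₀
      m≡ : monomial p e ≡ W * r₀ ^ c
      m≡ = trans (monomial-cong p (λ r _ → sym (update-self e r₀ r))) (split c)
      regroup : ∀ u v t → u * (v * t) ≡ v * (u * t)
      regroup = solve-∀
      wx≈ : w * x ≈ monomial p (update e r₀ k)
      wx≈ = begin
        (w * x) % p                  ≡⟨ ≈-* {w} {x} {r₀} {W * r₀ ^ c} (sym (%-≈ w)) (trans x≈m (cong (_% p) m≡)) ⟩
        (r₀ * (W * r₀ ^ c)) % p      ≡⟨ cong (_% p) (regroup r₀ W (r₀ ^ c)) ⟩
        (W * r₀ ^ suc c) % p         ≡⟨ ≈-* {W} {r₀ ^ suc c} {W} {r₀ ^ k} refl r₀^[1+c]≈r₀^k ⟩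
        (W * r₀ ^ k) % p             ≡⟨ cong (_% p) (sym (split k)) ⟩
        monomial p (update e r₀ k) % p ∎
        where open ≡-Reasoning

    realisable-product : ∀ {ws} → All (λ w → Rich (w % p)) ws → Realisable (product ws)
    realisable-product []               = realisable-1
    realisable-product (rich ∷ riches) = realisable-* rich (realisable-product riches)

  count-here : ∀ q L → count (q ∷ L) (q % p) ≡ suc (count L (q % p))
  count-here q L = cong length (filter-accept (λ x → x % p ≟ q % p) refl)

  count-there : ∀ q L {r} → q % p ≢ r → count (q ∷ L) r ≡ count L r
  count-there q L {r} q%p≢r = cong length (filter-reject (λ x → x % p ≟ r) q%p≢r)

  filling : ℕ → List ℕ → ℕ
  filling zero    L = 0
  filling (suc n) L = filling n L + (count L n ⊓ cap)

  filling-bound : ∀ n L → filling n L ≤ n * cap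
  filling-bound zero    L = z≤n
  filling-bound (suc n) L = subst (filling (suc n) L ≤_) (+-comm (n * cap) cap)
    (+-mono-≤ (filling-bound n L) (m⊓n≤n (count L n) cap))

  filling-unchanged : ∀ n q L → n ≤ q % p → filling n (q ∷ L) ≡ filling n L
  filling-unchanged zero    q L _       = refl
  filling-unchanged (suc n) q L n<q%p = cong₂ _+_ (filling-unchanged n q L (<⇒≤ n<q%p))
    (cong (_⊓ cap) (count-there q L (<⇒≢ n<q%p ∘ sym)))

  filling-grows : ∀ n q L → q % p < n → count L (q % p) < cap → filling n (q ∷ L) ≡ suc (filling n L)
  filling-grows (suc n) q L q%p<1+n below-cap = by-cases (q % p ≟ n)
    where
    by-cases : Dec (q % p ≡ n) → filling (suc n) (q ∷ L) ≡ suc (filling (suc n) L)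
    by-cases (yes q%p≡n) = begin
      filling n (q ∷ L) + (count (q ∷ L) n ⊓ cap)
        ≡⟨ cong₂ _+_ (filling-unchanged n q L (≤-reflexive (sym q%p≡n)))
                     (cong (λ r → count (q ∷ L) r ⊓ cap) (sym q%p≡n)) ⟩
      filling n L + (count (q ∷ L) (q % p) ⊓ cap)
        ≡⟨ cong (λ v → filling n L + (v ⊓ cap)) (count-here q L) ⟩
      filling n L + (suc (count L (q % p)) ⊓ cap)
        ≡⟨ cong (filling n L +_) (trans (m≤n⇒m⊓n≡m below-cap) (cong suc (sym (m≤n⇒m⊓n≡m (<⇒≤ below-cap))))) ⟩
      filling n L + suc (count L (q % p) ⊓ cap)
        ≡⟨ +-suc (filling n L) _ ⟩
      suc (filling n L + (count L (q % p) ⊓ cap))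
        ≡⟨ cong (λ r → suc (filling n L + (count L r ⊓ cap))) q%p≡n ⟩
      suc (filling n L + (count L n ⊓ cap)) ∎
      where open ≡-Reasoning
    by-cases (no q%p≢n) = cong₂ _+_
      (filling-grows n q L (≤∧≢⇒< (≤-pred q%p<1+n) q%p≢n) below-cap)
      (cong (_⊓ cap) (count-there q L q%p≢n))

-- A round starts from a duplicate-free list L ⊆ A of numbers prime to p and
-- either finds p ∈ A or a newcomer: a member of A outside L in a class that is
-- not rich.  Newcomers other than p raise the filling of L, which is bounded.
module Completion {A : Subset} (A-primes : SetOfPrimes A) (closed : Closed A) (pair : OddPair A)
                  {p : ℕ} (p-prime : Prime p) where
  open ClosedSet A-primes closed
  open Modulo p-prime

  Newcomer : List ℕ → Set
  Newcomer L = ∃ λ q → A q × q ∉ L × ¬ Realisation.Rich L (q % p)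

  module Round (L : List ℕ) (L-unique : Unique L) (L⊆A : All A L) (p∤L : All (λ q → ¬ p ∣ q) L)
               {q₀ : ℕ} (q₀∈L : q₀ ∈ L) where
    open Realisation L

    poor? : U.Decidable (λ q → ¬ Rich (q % p))
    poor? q = ¬? (rich? (q % p))

    poor : List ℕ
    poor = filter poor? L

    ∈-poor⁻ : ∀ {x} → x ∈ poor → x ∈ L × ¬ Rich (x % p)
    ∈-poor⁻ = ∈-filter⁻ poor? {xs = L}

    f : ℕ
    f = product poor

    p∤f : ¬ p ∣ f
    p∤f = ∤-product (All.tabulate λ q∈poor → All.lookup p∤L (proj₁ (∈-poor⁻ q∈poor)))

    -- For admissible e, the candidate set: the poor members together with select L p e.
    -- Its product is ≈ f · monomial p e, and it contains every poor member of L.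
    candidate : (ℕ → ℕ) → List ℕ
    candidate e = poor ++ select L p e

    candidate⊆L : ∀ e {x} → x ∈ candidate e → x ∈ L
    candidate⊆L e x∈ with ∈-++⁻ poor x∈
    ... | inj₁ x∈poor   = proj₁ (∈-poor⁻ x∈poor)
    ... | inj₂ x∈select = proj₁ (∈-select⁻ L p e x∈select)

    -- q₀ is a poor member, or its class is rich and contributes e(q₀ % p) ≥ 1 members.
    candidate-inhabited : ∀ {e} → Admissible e → ∃ λ x → x ∈ candidate e
    candidate-inhabited {e} adm with rich? (q₀ % p)
    ... | no  q₀-poor = q₀ , ∈-++⁺ˡ (∈-filter⁺ poor? q₀∈L q₀-poor)
    ... | yes q₀-rich =
      let x , x∈take = take-inhabited (e (q₀ % p)) (class L (q₀ % p)) (proj₁ (proj₁ (adm (q₀ % p)) q₀-rich))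
                         (≤-trans (≤-trans p≥1 (<⇒≤ p<cap)) (proj₂ (proj₂ q₀-rich)))
      in  x , ∈-++⁺ʳ poor (∈-select⁺ L p e (proj₁ (proj₂ q₀-rich)) x∈take)

    -- Selected members come from rich classes (their exponent is ≥ 1), so they are not poor.
    candidate-unique : ∀ {e} → Admissible e → Unique (candidate e)
    candidate-unique {e} adm =
      Unique.++⁺ (Unique.filter⁺ poor? L-unique) (select-unique L p e L-unique) disjoint
      where
      disjoint : ∀ {v} → ¬ (v ∈ poor × v ∈ select L p e)
      disjoint {v} (v∈poor , v∈select) with ∈-select⁻ L p e v∈select
      ... | _ , _ , e≥1 = contradiction (subst (1 ≤_) (proj₂ (adm (v % p)) (proj₂ (∈-poor⁻ v∈poor))) e≥1) λ ()

    -- The candidate lies in 𝒫⋆(A): it misses the member of A outside L that A's infinitude provides.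
    candidate-𝒫⋆ : ∀ {e} → Admissible e → FinNonemptyProperSubset A (candidate e)
    candidate-𝒫⋆ {e} adm with unbounded pair L L⊆A
    ... | y , y∈A , y∉L = in-𝒫⋆ (candidate-unique adm) (All.tabulate (All.lookup L⊆A ∘ candidate⊆L e))
                            (proj₂ (candidate-inhabited adm)) y∈A (y∉L ∘ candidate⊆L e)

    candidate+1≈ : ∀ {e x} → Admissible e → x ≈ monomial p e → product (candidate e) + 1 ≈ f * x + 1
    candidate+1≈ {e} {x} adm x≈m = ≈-+ {product (candidate e)} {1} {f * x} {1} ∏candidate≈fx refl
      where
      ∏candidate≈fx : product (candidate e) ≈ f * x
      ∏candidate≈fx = trans (cong (_% p) (product-++ poor (select L p e)))
        (≈-* {f} {product (select L p e)} {f} {x} refl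
          (trans (product-select L p e (λ r _ → admissible-fits adm r)) (sym x≈m)))

    -- If x is realisable then so is f·x + 1 ≈ ∏(candidate) + 1 when all its prime
    -- divisors have rich residues; otherwise a prime divisor in a poor class is a
    -- newcomer: it lies in A by closedness and not in L, as poor members of L are in the candidate.
    step : ∀ {x} → Realisable x → Newcomer L ⊎ Realisable (f * x + 1)
    step {x} (e , adm , x≈m)
      with prime-divisors-dichotomy (λ q → rich? (q % p)) (product (candidate e) + 1) {{+1-nonZero _}}
    ... | inj₁ (q , q-prime , q∣N , q-poor) =
      inj₁ (q , closed _ (candidate-𝒫⋆ adm) q q-prime q∣N , q∉L , q-poor)
      where
      q∉L : q ∉ L
      q∉L q∈L = ∈⇒∤product+1 q-prime (∈-++⁺ˡ (∈-filter⁺ poor? q∈L q-poor)) q∣N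
    ... | inj₂ all-rich with product-of-prime-divisors (product (candidate e) + 1) {{+1-nonZero _}} all-rich
    ...   | ws , ws-rich , ∏ws≡N = inj₂ (realisable-resp (candidate+1≈ adm x≈m)
                                       (subst Realisable ∏ws≡N (realisable-product ws-rich)))

    walk : ∀ j → Newcomer L ⊎ Realisable (orbit f (suc j))
    walk zero    = inj₂ (realisable-resp (cong (λ v → (v + 1) % p) (sym (*-zeroʳ f))) realisable-1)
    walk (suc j) with walk j
    ... | inj₁ new        = inj₁ new
    ... | inj₂ realisable = step realisable

    -- Once the orbit reaches 0 mod p, p divides ∏(candidate) + 1 and lies in A.
    newcomer-or-p : Newcomer L ⊎ A p
    newcomer-or-p = at-return (orbit-returns f p∤f)
      where
      at-return : (∃ λ j → p ∣ orbit f (2 + j)) → Newcomer L ⊎ A p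
      at-return (j , p∣orbit) = map₂ p∈A (walk j)
        where
        p∈A : Realisable (orbit f (suc j)) → A p
        p∈A (e , adm , x≈m) = closed (candidate e) (candidate-𝒫⋆ adm) p p-prime
          (∣-resp-≈ (candidate+1≈ adm x≈m) p∣orbit)

  -- Rounds are repeated with the newcomer added to L; the fuel bounds the number of
  -- rounds since the filling grows each time and never exceeds p·cap.
  grow : ∀ fuel L → Unique L → All A L → All (λ q → ¬ p ∣ q) L → ∀ {q₀} → q₀ ∈ L →
    p * cap < filling p L + fuel → A p
  grow zero L _ _ _ _ enough =
    contradiction enough (≤⇒≯ (subst (_≤ p * cap) (sym (+-identityʳ _)) (filling-bound p L)))
  grow (suc fuel) L L-unique L⊆A p∤L q₀∈L enough =
    [ admit , id ]′ (Round.newcomer-or-p L L-unique L⊆A p∤L q₀∈L)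
    where
    admit : Newcomer L → A p
    admit (q , q∈A , q∉L , q-poor) = by-cases (q ≟ p)
      where
      by-cases : Dec (q ≡ p) → A p
      by-cases (yes q≡p) = subst A q≡p q∈A
      by-cases (no  q≢p) =
        grow fuel (q ∷ L) (∷-unique q∉L L-unique) (q∈A ∷ L⊆A) (p∤q ∷ p∤L) (there q₀∈L) enough′
        where
        p∤q : ¬ p ∣ q
        p∤q p∣q = q≢p (sym (prime∣prime⇒≡ (A-primes q q∈A) p-prime p∣q))
        below-cap : count L (q % p) < cap
        below-cap = ≰⇒> λ cap≤count → q-poor (∤⇒≥1 (p∤q ∘ ∣n∣m%n⇒∣m ∣-refl) , m%n<n q p , cap≤count)
        enough′ : p * cap < filling p (q ∷ L) + fuel
        enough′ = subst (p * cap <_)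
          (trans (+-suc (filling p L) fuel) (cong (_+ fuel) (sym (filling-grows p q L (m%n<n q p) below-cap)))) enough

  p∈A : p ≢ 2 → A p
  p∈A p≢2 = grow (p * cap + 1) (2 ∷ []) ([] ∷ []) (2∈A pair ∷ []) (p∤2 ∷ []) (here refl)
    (<-≤-trans (m<m+n (p * cap) (s≤s z≤n)) (m≤n+m (p * cap + 1) (filling p (2 ∷ []))))
    where
    p∤2 : ¬ p ∣ 2
    p∤2 p∣2 = p≢2 (prime∣prime⇒≡ prime[2] p-prime p∣2)

lemma10 : (A : Subset) → SetOfPrimes A → AtLeast3 A →
    (∀ (B : List ℕ) → FinNonemptyProperSubset A B →
    ∀ q → Prime q → q ∣ product B + 1 → A q) →
    ∀ p → Prime p → A p
lemma10 A A-primes at-least-3 closed p p-prime with p ≟ 2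
... | yes refl = ClosedSet.2∈A A-primes closed (odd-pair at-least-3)
... | no  p≢2  = Completion.p∈A A-primes closed (odd-pair at-least-3) p-prime p≢2
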